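{- (i) For a forest $f$ whose roots are maximal elements, $B_+(f)=M_{s,t}(f)$ with $s_0=1$, $s_i=0$ for $i>0$ and $t_j=1$ for all $j$. (ii) For a rooted tree $T$ whose root is its minimal element, $N(T)=M_{s,t}(T)$ with $t_1=1$, $t_i=0$ for $i\neq1$ and $s_j=1$ for all $j$. (iii) For real $t_0,t_1,\ldots\ge0$ and any unlabelled poset $C_n$ with $n$ elements, $\sum_{C_{n+1}}w(C_n\to C_{n+1})\,C_{n+1}=M_{s,t}(C_n)$ with $s_i=1$ for all $i$, where the sum is over all unlabelled posets $C_{n+1}$ obtained from $C_n$ by adding a new maximal element.
   Context: For a poset $P$ and subset $S$ of its elements, $D(S)=\{y:\exists x\in S,\ y\preceq x\}$ and $B_S(P)$ is $P$ with one new element added above every element of $D(S)$ and incomparable to all others. $M_{s,t}$ is the linear map on the span of finite unlabelled posets with $M_{s,t}(P)=\sum_{S\subseteq P}t_{|S|}s_{|P|-|S|}B_S(P)$ (sum over subsets of the elements of a representative). For a forest $f$ viewed as a poset with roots maximal, $B_+(f)$ adds a new element above all elements of $f$ (a new root). For a rooted tree $T$ viewed as a poset with root minimal (every non-root element covers exactly one element), $N(T)$ is the sum of all trees obtained by adding a new leaf, i.e. $\sum_{a\in T}$ of $T$ with a new element covering $a$ only; extended linearly. CSG weights: $\lambda(k,p)=\sum_{i=0}^{k-p}\binom{k-p}{i}t_{p+i}$; for a fixed naturally labelled representative $\tilde C_n$ of $C_n$ (poset on $\{1,\ldots,n\}$ with $x\prec y\Rightarrow x<y$), $w(C_n\to C_{n+1})$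 is the sum, over all naturally labelled $\tilde C_{n+1}$ isomorphic to $C_{n+1}$ whose restriction to $\{1,\ldots,n\}$ is $\tilde C_n$, of $\lambda(\varpi,m)$, where $\varpi$ is the number of elements below $n+1$ and $m$ the number of elements covered by $n+1$. -}

module Defs where

open import Level using (Level)
open import Data.Bool using (Bool; true; false; T; _∧_; _∨_; not; if_then_else_)
open import Data.Nat using (ℕ; zero; suc; _∸_; _<ᵇ_)
open import Data.Nat.Combinatorics using (_C_)
open import Data.Fin using (Fin; zero; suc; toℕ)
import Data.Fin as Fin
open import Data.Maybe using (Maybe; just; nothing)
import Data.Maybe as Maybe
open import Data.List using (List; []; _∷_; [_]; map; concatMap; foldr; filter; upTo; length; applyUpTo)
import Data.List as List
open import Data.Vec using (Vec; lookup; _∷_; [])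
import Data.Vec as Vec
open import Data.Product using (Σ; _×_; _,_; proj₁; proj₂)
open import Data.Empty using (⊥)
open import Relation.Nullary using (¬_)
open import Relation.Nullary.Decidable using (⌊_⌋; yes; no)
open import Relation.Binary.PropositionalEquality using (_≡_; _≢_; refl)
open import Algebra.Bundles using (CommutativeSemiring)
import Data.Nat as ℕ

Rel : ℕ → Set
Rel n = Fin n → Fin n → Bool

_==ᶠ_ : ∀ {n} → Fin n → Fin n → Bool
x ==ᶠ y = ⌊ x Fin.≟ y ⌋

_==ᵇ_ : Bool → Bool → Bool
true ==ᵇ b = b
false ==ᵇ b = not b

-- x ≤ y in R is  T (R x y)
record IsPoset {n : ℕ} (R : Rel n) : Set where
  field
    reflexive : ∀ x → T (R x x)
    antisym   : ∀ x y → T (R x y) → T (R y x) → x ≡ y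
    transitive : ∀ x y z → T (R x y) → T (R y z) → T (R x z)

_⊢_≺_ : ∀ {n} → Rel n → Fin n → Fin n → Set
R ⊢ x ≺ y = T (R x y) × x ≢ y

ltᵇ : ∀ {n} → Rel n → Fin n → Fin n → Bool
ltᵇ R x y = R x y ∧ not (x ==ᶠ y)

_⊢_⋖_ : ∀ {n} → Rel n → Fin n → Fin n → Set
R ⊢ x ⋖ y = (R ⊢ x ≺ y) × (∀ z → R ⊢ x ≺ z → R ⊢ z ≺ y → ⊥)

-- forest with roots maximal: every element is covered by at most one element
IsForest : ∀ {n} → Rel n → Set
IsForest R = ∀ x y z → R ⊢ x ⋖ y → R ⊢ x ⋖ z → y ≡ z

-- rooted tree with root minimal (the minimum), every non-root element
-- covers exactly one element
IsRootedTree : ∀ {n} → Rel n → Set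
IsRootedTree {n} R =
  Σ (Fin n) λ root →
    (∀ x → T (R root x)) ×
    (∀ x → x ≢ root → Σ (Fin n) λ y → (R ⊢ y ⋖ x) × (∀ y' → R ⊢ y' ⋖ x → y' ≡ y))

allFin : ∀ n → List (Fin n)
allFin n = List.allFin n

anyᵇ : ∀ {A : Set} → List A → (A → Bool) → Bool
anyᵇ xs p = foldr (λ x acc → p x ∨ acc) false xs

allᵇ : ∀ {A : Set} → List A → (A → Bool) → Bool
allᵇ xs p = foldr (λ x acc → p x ∧ acc) true xs

countᵇ : ∀ n → (Fin n → Bool) → ℕ
countᵇ n p = length (filter (λ x → T? (p x)) (allFin n))
  where
  open import Relation.Nullary.Decidable using (Dec)
  T? : (b : Bool) → Dec (T b)
  T? true = yes _
  T? false = no (λ ())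

vecsOver : ∀ {A : Set} → List A → (k : ℕ) → List (Vec A k)
vecsOver xs zero = [ [] ]
vecsOver xs (suc k) = concatMap (λ v → map (_∷ v) xs) (vecsOver xs k)

bools : List Bool
bools = true ∷ false ∷ []

subsets : ∀ n → List (Vec Bool n)
subsets n = vecsOver bools n

card : ∀ {n} → Vec Bool n → ℕ
card {n} S = countᵇ n (lookup S)

isoᵇ : ∀ {m k} → Rel m → Rel k → Bool
isoᵇ {m} {k} P Q with m ℕ.≟ k
... | no _ = false
... | yes refl = anyᵇ (vecsOver (allFin m) m) λ f →
        allᵇ (allFin m) (λ x → allᵇ (allFin m) λ y →
          ((lookup f x ==ᶠ lookup f y) ∧ not (x ==ᶠ y)) ==ᵇ false)
        ∧ allᵇ (allFin m) (λ x → allᵇ (allFin m) λ y →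
          P x y ==ᵇ Q (lookup f x) (lookup f y))

toOld : ∀ {n} → Fin (suc n) → Maybe (Fin n)
toOld {zero} zero = nothing
toOld {suc n} zero = just zero
toOld {suc n} (suc i) = Maybe.map suc (toOld i)

-- glue R below above self: relation on Fin (suc n) restricting to R on the
-- old elements; below x = [x ≤ new], above x = [new ≤ x], self = [new ≤ new]
glue : ∀ {n} → Rel n → (Fin n → Bool) → (Fin n → Bool) → Bool → Rel (suc n)
glue R below above self x y with toOld x | toOld y
... | just a  | just b  = R a b
... | just a  | nothing = below a
... | nothing | just b  = above b
... | nothing | nothing = self

addAbove : ∀ {n} → Rel n → (Fin n → Bool) → Rel (suc n)
addAbove R d = glue R d (λ _ → false) true

downᵇ : ∀ {n} → Rel n → Vec Bool n → Fin n → Bool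
downᵇ {n} R S y = anyᵇ (allFin n) λ x → lookup S x ∧ R y x

B : ∀ {n} → Rel n → Vec Bool n → Rel (suc n)
B R S = addAbove R (downᵇ R S)

B₊ : ∀ {n} → Rel n → Rel (suc n)
B₊ R = addAbove R (λ _ → true)

-- T with a new element covering a only (order generated: above exactly ↓a)
addLeaf : ∀ {n} → Rel n → Fin n → Rel (suc n)
addLeaf R a = addAbove R (λ y → R y a)

module Span {c ℓ} (𝓡 : CommutativeSemiring c ℓ) where
  open CommutativeSemiring 𝓡

  Obj : Set
  Obj = Σ ℕ Rel

  -- a formal sum Σ cᵢ [Pᵢ] ; [P] is the isomorphism class of P
  FSum : Set c
  FSum = List (Carrier × Obj)

  coeff : ∀ {m} → Rel m → FSum → Carrier
  coeff Q = foldr (λ { (a , (k , P)) acc → if isoᵇ P Q then a + acc else acc }) 0#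

  _≋_ : FSum → FSum → Set ℓ
  L ≋ L' = ∀ m (Q : Rel m) → coeff Q L ≈ coeff Q L'

  Σ[_]_ : ∀ {A : Set} → List A → (A → Carrier) → Carrier
  Σ[ xs ] f = foldr (λ x acc → f x + acc) 0# xs

  _·_ : ℕ → Carrier → Carrier
  zero · x = 0#
  suc k · x = x + k · x

  M : (s t : ℕ → Carrier) → ∀ {n} → Rel n → FSum
  M s t {n} R = map (λ S → (t (card S) * s (n ∸ card S) , (suc n , B R S))) (subsets n)

  N : ∀ {n} → Rel n → FSum
  N {n} R = map (λ a → (1# , (suc n , addLeaf R a))) (allFin n)

  lam : (t : ℕ → Carrier) → ℕ → ℕ → Carrier
  lam t k p = Σ[ upTo (suc (k ∸ p)) ] λ i → ((k ∸ p) C i) · t (p ℕ.+ i)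

  isPosetᵇ : ∀ {n} → Rel n → Bool
  isPosetᵇ {n} R =
    allᵇ (allFin n) (λ x → R x x)
    ∧ allᵇ (allFin n) (λ x → allᵇ (allFin n) λ y → not (R x y ∧ R y x ∧ not (x ==ᶠ y)))
    ∧ allᵇ (allFin n) (λ x → allᵇ (allFin n) λ y → allᵇ (allFin n) λ z →
         not (R x y ∧ R y z ∧ not (R x z)))

  -- natural labelling: x ≺ y ⇒ x < y (labels 0..n-1 here)
  natLabᵇ : ∀ {n} → Rel n → Bool
  natLabᵇ {n} R = allᵇ (allFin n) λ x → allᵇ (allFin n) λ y →
    not (ltᵇ R x y) ∨ (toℕ x <ᵇ toℕ y)

  NatLabelled : ∀ {n} → Rel n → Set
  NatLabelled R = T (natLabᵇ R)

  -- all naturally labelled posets on Fin (suc n) whose restriction to the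
  -- first n labels is R (every relation with restriction R is a glue)
  extensions : ∀ {n} → Rel n → List (Rel (suc n))
  extensions {n} R =
    filter (λ Q → T? (isPosetᵇ Q ∧ natLabᵇ Q))
      (concatMap (λ bl → concatMap (λ ab → map (λ sf →
          glue R (lookup bl) (lookup ab) sf) bools) (vecsOver bools n))
        (vecsOver bools n))
    where
    open import Relation.Nullary.Decidable using (Dec)
    T? : (b : Bool) → Dec (T b)
    T? true = yes _
    T? false = no (λ ())

  newElt : ∀ n → Fin (suc n)
  newElt n = Fin.fromℕ n

  varpi : ∀ {n} → Rel (suc n) → ℕ
  varpi {n} Q = countᵇ (suc n) λ y → ltᵇ Q y (newElt n)

  coveredCount : ∀ {n} → Rel (suc n) → ℕ
  coveredCount {n} Q = countᵇ (suc n) λ y →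
    ltᵇ Q y (newElt n) ∧ not (anyᵇ (allFin (suc n)) λ z → ltᵇ Q y z ∧ ltᵇ Q z (newElt n))

  -- w(C_n → [Q]) for the fixed representative R of C_n: sum over the
  -- naturally labelled extensions of R isomorphic to Q of λ(ϖ, m)
  -- (it is 0 if [Q] is not obtained from C_n by adding a maximal element)
  w : (t : ℕ → Carrier) → ∀ {n m} → Rel n → Rel m → Carrier
  w t R Q = Σ[ filter (λ Q' → T? (isoᵇ Q' Q)) (extensions R) ]
              λ Q' → lam t (varpi Q') (coveredCount Q')
    where
    open import Relation.Nullary.Decidable using (Dec)
    T? : (b : Bool) → Dec (T b)
    T? true = yes _
    T? false = no (λ ())

-- Expand M_{s,t}(P) = Σ_S t_{|S|} s_{|P|-|S|} B_S(P) and read off which terms survive.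
-- In (i) only S = P survives, and B_P(f) = B₊(f) since every element lies below itself;
-- in (ii) only singletons S = {a} survive, and B_{a}(T) is T with a new leaf on a.
-- In (iii), a naturally labelled extension of R by a new element is a poset exactly when the
-- new element is maximal (it carries the largest label) and the set D of elements below it is
-- down-closed; it is then B_S(R) for every S with D(S) = D, and ϖ = |D|, m = |max D|. In a
-- finite poset D(S) = D holds iff max D ⊆ S ⊆ D, so the terms of M_{1,t}(R) belonging to D add
-- up to Σ_i binom(|D| - |max D|, i) t_{|max D| + i} = λ(ϖ, m), the weight of that extension.

module Submission where

open import Defs
open import Data.Bool using (Bool; true; false; T; _∧_; _∨_; not; if_then_else_)
import Data.Bool.Properties as Boolₚ
open Boolₚ using (∧-identityʳ; ∧-comm; T-≡; T-∧; T-∨)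
open import Data.Empty using (⊥-elim)
open import Data.Fin using (Fin; zero; suc; toℕ; inject₁; fromℕ; _>_)
open import Data.Fin.Induction using (>-wellFounded)
import Data.Fin.Properties as Fin
open import Data.List using (List; []; _∷_; [_]; map; concatMap; filter; length; tabulate; _++_; upTo)
open import Data.List.Properties using (foldr-map; map-tabulate; map-applyUpTo; upTo-∷ʳ)
open import Data.Maybe using (just; nothing)
open import Data.Nat as ℕ using (ℕ; zero; suc; _∸_; _<_; _≤_; z≤n; s≤s)
open import Data.Nat.Combinatorics using (_C_; nCk+nC[k+1]≡[n+1]C[k+1]; k>n⇒nCk≡0)
import Data.Nat.Properties as ℕₚ
open import Data.Product using (∃; _×_; _,_; proj₁; proj₂)
open import Data.Sum using (_⊎_; inj₁; inj₂)
open import Data.Vec using (Vec; lookup; _∷_; [])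
import Data.Vec as Vec
open import Data.Vec.Properties using (lookup∘tabulate; tabulate∘lookup; tabulate-cong; ≡-dec)
open import Function using (_∘_; id)
open import Function.Bundles using (_⇔_; mk⇔; Equivalence)
open import Function.Construct.Composition using (_⇔-∘_)
open import Induction.WellFounded using (Acc; acc)
open import Relation.Nullary using (¬_; Dec; yes; no; does)
open import Relation.Nullary.Decidable using (T?)
open import Relation.Binary.PropositionalEquality
  using (_≡_; _≢_; refl; sym; trans; cong; cong₂; subst; subst₂; module ≡-Reasoning)
open import Algebra.Bundles using (CommutativeSemiring)

private
  variable
    X Y : Set
    n : ℕ

-- Booleans

T-ext : ∀ {a b} → (T a → T b) → (T b → T a) → a ≡ b
T-ext {true}  {true}  _ _ = refl
T-ext {true}  {false} f _ = ⊥-elim (f _)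
T-ext {false} {true}  _ g = ⊥-elim (g _)
T-ext {false} {false} _ _ = refl

T⇒≡true : ∀ {a} → T a → a ≡ true
T⇒≡true = Equivalence.to T-≡

¬T⇒≡false : ∀ {a} → ¬ T a → a ≡ false
¬T⇒≡false {true}  ¬a = ⊥-elim (¬a _)
¬T⇒≡false {false} _  = refl

∧-intro : ∀ {a b} → T a → T b → T (a ∧ b)
∧-intro a b = Equivalence.from T-∧ (a , b)

∧-proj₁ : ∀ {a b} → T (a ∧ b) → T a
∧-proj₁ = proj₁ ∘ Equivalence.to T-∧

∧-proj₂ : ∀ {a b} → T (a ∧ b) → T b
∧-proj₂ = proj₂ ∘ Equivalence.to T-∧

not-intro : ∀ {a} → ¬ T a → T (not a)
not-intro {true}  ¬a = ¬a _
not-intro {false} _  = _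

not-elim : ∀ {a} → T (not a) → ¬ T a
not-elim {false} _ ()

∨-introˡ : ∀ {a b} → T a → T (a ∨ b)
∨-introˡ = Equivalence.from T-∨ ∘ inj₁

∨-introʳ : ∀ {a b} → T b → T (a ∨ b)
∨-introʳ = Equivalence.from T-∨ ∘ inj₂

∨-elim : ∀ {a b} → T (a ∨ b) → T a ⊎ T b
∨-elim = Equivalence.to T-∨

⇒-intro : ∀ {a b} → (T a → T b) → T (not a ∨ b)
⇒-intro {true}  f = f _
⇒-intro {false} _ = _

⇒-elim : ∀ {a b} → T (not a ∨ b) → T a → T b
⇒-elim {true} b _ = b

⇒₂-intro : ∀ {a b c} → (T a → T b → T c) → T (not (a ∧ b ∧ not c))
⇒₂-intro {true} {true} {true}  _ = _
⇒₂-intro {true} {true} {false} f = f _ _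
⇒₂-intro {true} {false}        _ = _
⇒₂-intro {false}               _ = _

⇒₂-elim : ∀ {a b c} → T (not (a ∧ b ∧ not c)) → T a → T b → T c
⇒₂-elim {true} {true} {true} _ _ _ = _

does⇔ : ∀ {a} {P : Set a} (d : Dec P) → T (does d) ⇔ P
does⇔ (yes p) = mk⇔ (λ _ → p) _
does⇔ (no ¬p) = mk⇔ (λ ()) ¬p

fromBool : Bool → ℕ
fromBool b = if b then 1 else 0

==ᶠ⇒≡ : ∀ {x y : Fin n} → T (x ==ᶠ y) → x ≡ y
==ᶠ⇒≡ {x = x} {y} h with x Fin.≟ y
... | yes x≡y = x≡y

≡⇒==ᶠ : ∀ {x y : Fin n} → x ≡ y → T (x ==ᶠ y)
≡⇒==ᶠ {x = x} refl with x Fin.≟ x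
... | yes _  = _
... | no x≢x = x≢x refl

≢⇒==ᶠ : ∀ {x y : Fin n} → x ≢ y → (x ==ᶠ y) ≡ false
≢⇒==ᶠ x≢y = ¬T⇒≡false (x≢y ∘ ==ᶠ⇒≡)

suc-==ᶠ : ∀ (i a : Fin n) → (suc i ==ᶠ suc a) ≡ (i ==ᶠ a)
suc-==ᶠ i a = T-ext (≡⇒==ᶠ ∘ Fin.suc-injective ∘ ==ᶠ⇒≡) (≡⇒==ᶠ ∘ cong suc ∘ ==ᶠ⇒≡)

-- Quantifiers and counting over finite sets

anyᵇ-cong : ∀ (xs : List X) {p q : X → Bool} → (∀ x → p x ≡ q x) → anyᵇ xs p ≡ anyᵇ xs q
anyᵇ-cong []       _   = refl
anyᵇ-cong (x ∷ xs) p≗q = cong₂ _∨_ (p≗q x) (anyᵇ-cong xs p≗q)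

allᵇ-cong : ∀ (xs : List X) {p q : X → Bool} → (∀ x → p x ≡ q x) → allᵇ xs p ≡ allᵇ xs q
allᵇ-cong []       _   = refl
allᵇ-cong (x ∷ xs) p≗q = cong₂ _∧_ (p≗q x) (allᵇ-cong xs p≗q)

anyᵇ-tabulate⁺ : ∀ {p : X → Bool} (f : Fin n → X) i → T (p (f i)) → T (anyᵇ (tabulate f) p)
anyᵇ-tabulate⁺ f zero    h = ∨-introˡ h
anyᵇ-tabulate⁺ {p = p} f (suc i) h = ∨-introʳ {p (f zero)} (anyᵇ-tabulate⁺ (f ∘ suc) i h)

anyᵇ-tabulate⁻ : ∀ {p : X → Bool} (f : Fin n → X) → T (anyᵇ (tabulate f) p) → ∃ λ i → T (p (f i))
anyᵇ-tabulate⁻ {n = suc n} {p = p} f h with ∨-elim {p (f zero)} h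
... | inj₁ h₀ = zero , h₀
... | inj₂ hs with anyᵇ-tabulate⁻ (f ∘ suc) hs
...   | i , hi = suc i , hi

allᵇ-tabulate⁺ : ∀ {p : X → Bool} (f : Fin n → X) → (∀ i → T (p (f i))) → T (allᵇ (tabulate f) p)
allᵇ-tabulate⁺ {n = zero}  f h = _
allᵇ-tabulate⁺ {n = suc n} f h = ∧-intro (h zero) (allᵇ-tabulate⁺ (f ∘ suc) (h ∘ suc))

allᵇ-tabulate⁻ : ∀ {p : X → Bool} (f : Fin n → X) → T (allᵇ (tabulate f) p) → ∀ i → T (p (f i))
allᵇ-tabulate⁻ f h zero    = ∧-proj₁ h
allᵇ-tabulate⁻ {p = p} f h (suc i) = allᵇ-tabulate⁻ (f ∘ suc) (∧-proj₂ {p (f zero)} h) i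

allFin-suc : ∀ n → allFin (suc n) ≡ zero ∷ map suc (allFin n)
allFin-suc n = cong (zero ∷_) (sym (map-tabulate id suc))

allᵇ-allFin-suc : ∀ (p : Fin (suc n) → Bool) →
  allᵇ (allFin (suc n)) p ≡ p zero ∧ allᵇ (allFin n) (p ∘ suc)
allᵇ-allFin-suc {n} p =
  trans (cong (λ xs → allᵇ xs p) (allFin-suc n)) (cong (p zero ∧_) (foldr-map _ suc true (allFin n)))

length-filter-tabulate : ∀ {p : X → Bool} {q : Y → Bool}
  (P? : ∀ x → Dec (T (p x))) (Q? : ∀ y → Dec (T (q y))) (f : Fin n → X) (g : Fin n → Y) → (∀ i → p (f i) ≡ q (g i)) →
  length (filter P? (tabulate f)) ≡ length (filter Q? (tabulate g))
length-filter-tabulate {n = zero}  P? Q? f g e = refl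
length-filter-tabulate {n = suc n} P? Q? f g e with P? (f zero) | Q? (g zero)
... | yes _  | yes _  = cong suc (length-filter-tabulate P? Q? (f ∘ suc) (g ∘ suc) (e ∘ suc))
... | no  _  | no  _  = length-filter-tabulate P? Q? (f ∘ suc) (g ∘ suc) (e ∘ suc)
... | yes pf | no ¬qg = ⊥-elim (¬qg (subst T (e zero) pf))
... | no ¬pf | yes qg = ⊥-elim (¬pf (subst T (sym (e zero)) qg))

length-filter-tabulate-suc : ∀ {p : X → Bool} (P? : ∀ x → Dec (T (p x))) (f : Fin (suc n) → X) →
  length (filter P? (tabulate f)) ≡ fromBool (p (f zero)) ℕ.+ length (filter P? (tabulate (f ∘ suc)))
length-filter-tabulate-suc P? f with P? (f zero)
... | yes pf rewrite T⇒≡true pf = refl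
... | no ¬pf rewrite ¬T⇒≡false ¬pf = refl

countᵇ-cong : ∀ n {p q : Fin n → Bool} → (∀ i → p i ≡ q i) → countᵇ n p ≡ countᵇ n q
countᵇ-cong n e = length-filter-tabulate _ _ id id e

countᵇ-filter : ∀ n (p : Fin n → Bool) → countᵇ n p ≡ length (filter (T? ∘ p) (allFin n))
countᵇ-filter n p = length-filter-tabulate _ (T? ∘ p) id id (λ _ → refl)

countᵇ-suc : ∀ n (p : Fin (suc n) → Bool) → countᵇ (suc n) p ≡ fromBool (p zero) ℕ.+ countᵇ n (p ∘ suc)
countᵇ-suc n p = begin
  countᵇ (suc n) p                                                ≡⟨ countᵇ-filter (suc n) p ⟩
  length (filter (T? ∘ p) (allFin (suc n)))                       ≡⟨ length-filter-tabulate-suc (T? ∘ p) id ⟩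
  fromBool (p zero) ℕ.+ length (filter (T? ∘ p) (tabulate suc))     ≡⟨ cong (fromBool (p zero) ℕ.+_) shift ⟩
  fromBool (p zero) ℕ.+ countᵇ n (p ∘ suc)                          ∎
  where
  open ≡-Reasoning
  shift : length (filter (T? ∘ p) (tabulate suc)) ≡ countᵇ n (p ∘ suc)
  shift = trans (length-filter-tabulate (T? ∘ p) (T? ∘ p ∘ suc) suc id (λ _ → refl))
                (sym (countᵇ-filter n (p ∘ suc)))

countᵇ-last : ∀ n (p : Fin (suc n) → Bool) →
  countᵇ (suc n) p ≡ countᵇ n (p ∘ inject₁) ℕ.+ fromBool (p (fromℕ n))
countᵇ-last zero    p = trans (countᵇ-suc 0 p) (ℕₚ.+-comm (fromBool (p zero)) 0)
countᵇ-last (suc n) p = begin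
  countᵇ (suc (suc n)) p                        ≡⟨ countᵇ-suc (suc n) p ⟩
  b₀ ℕ.+ countᵇ (suc n) (p ∘ suc)               ≡⟨ cong (b₀ ℕ.+_) (countᵇ-last n (p ∘ suc)) ⟩
  b₀ ℕ.+ (countᵇ n (p ∘ suc ∘ inject₁) ℕ.+ bₙ)  ≡⟨ ℕₚ.+-assoc b₀ _ bₙ ⟨
  b₀ ℕ.+ countᵇ n (p ∘ suc ∘ inject₁) ℕ.+ bₙ    ≡⟨ cong (ℕ._+ bₙ) (countᵇ-suc n (p ∘ inject₁)) ⟨
  countᵇ (suc n) (p ∘ inject₁) ℕ.+ bₙ           ∎
  where
  open ≡-Reasoning
  b₀ bₙ : ℕ
  b₀ = fromBool (p zero)
  bₙ = fromBool (p (fromℕ (suc n)))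

-- Subsets as Boolean vectors

_⊆_ : (Fin n → Bool) → (Fin n → Bool) → Set
p ⊆ q = ∀ i → T (p i) → T (q i)

card-∷ : ∀ x (S : Vec Bool n) → card (x ∷ S) ≡ fromBool x ℕ.+ card S
card-∷ x S = countᵇ-suc _ (lookup (x ∷ S))

card-mono : ∀ {a b : Vec Bool n} → lookup a ⊆ lookup b → card a ≤ card b
card-mono {a = []}    {[]}    _   = z≤n
card-mono {a = x ∷ a} {y ∷ b} a⊆b rewrite card-∷ x a | card-∷ y b with x | y | a⊆b zero
... | true  | true  | _ = s≤s (card-mono {a = a} {b} (a⊆b ∘ suc))
... | false | true  | _ = ℕₚ.m≤n⇒m≤1+n (card-mono {a = a} {b} (a⊆b ∘ suc))
... | false | false | _ = card-mono {a = a} {b} (a⊆b ∘ suc)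
... | true  | false | f = ⊥-elim (f _)

card≤n : ∀ (S : Vec Bool n) → card S ≤ n
card≤n []          = z≤n
card≤n (true  ∷ S) rewrite card-∷ true S  = s≤s (card≤n S)
card≤n (false ∷ S) rewrite card-∷ false S = ℕₚ.m≤n⇒m≤1+n (card≤n S)

∅ full : Vec Bool n
∅    = Vec.tabulate (λ _ → false)
full = Vec.tabulate (λ _ → true)

_≟ᵛ_ : (u v : Vec Bool n) → Dec (u ≡ v)
_≟ᵛ_ = ≡-dec Boolₚ._≟_

≡tabulate⇔ : ∀ (v : Vec Bool n) f → v ≡ Vec.tabulate f ⇔ (∀ i → lookup v i ≡ f i)
≡tabulate⇔ v f = mk⇔ (λ v≡ i → trans (cong (λ u → lookup u i) v≡) (lookup∘tabulate f i))
  (λ v≗f → trans (sym (tabulate∘lookup v)) (tabulate-cong v≗f))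

does-≟-∅ : ∀ (S : Vec Bool n) → does (S ≟ᵛ ∅) ≡ (card S ℕ.≡ᵇ 0)
does-≟-∅ []          = refl
does-≟-∅ (true  ∷ S) = refl
does-≟-∅ (false ∷ S) rewrite card-∷ false S = does-≟-∅ S

singleton : Fin n → Vec Bool n
singleton a = Vec.tabulate (_==ᶠ a)

singleton-suc : ∀ (a : Fin n) → singleton (suc a) ≡ false ∷ singleton a
singleton-suc a = cong (false ∷_) (tabulate-cong λ i → suc-==ᶠ i a)

inIntervalᵇ : Vec Bool n → Vec Bool n → Vec Bool n → Bool
inIntervalᵇ {n} a b S = allᵇ (allFin n) λ i → (not (lookup a i) ∨ lookup S i) ∧ (not (lookup S i) ∨ lookup b i)

inIntervalᵇ-∷ : ∀ x y z (a b S : Vec Bool n) →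
  inIntervalᵇ (x ∷ a) (y ∷ b) (z ∷ S) ≡ ((not x ∨ z) ∧ (not z ∨ y)) ∧ inIntervalᵇ a b S
inIntervalᵇ-∷ x y z a b S = allᵇ-allFin-suc
  (λ i → (not (lookup (x ∷ a) i) ∨ lookup (z ∷ S) i) ∧ (not (lookup (z ∷ S) i) ∨ lookup (y ∷ b) i))

inIntervalᵇ⇔ : ∀ (a b S : Vec Bool n) → T (inIntervalᵇ a b S) ⇔ (lookup a ⊆ lookup S × lookup S ⊆ lookup b)
inIntervalᵇ⇔ a b S = mk⇔
  (λ h → (λ i → ⇒-elim (∧-proj₁ (allᵇ-tabulate⁻ id h i)))
        , (λ i → ⇒-elim (∧-proj₂ {not (lookup a i) ∨ lookup S i} (allᵇ-tabulate⁻ id h i))))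
  (λ (a⊆S , S⊆b) → allᵇ-tabulate⁺ id λ i → ∧-intro (⇒-intro (a⊆S i)) (⇒-intro (S⊆b i)))

-- Adding a new last element

data OldOrNew : Fin (suc n) → Set where
  old : (i : Fin n) → OldOrNew (inject₁ i)
  new : OldOrNew (fromℕ n)

oldOrNew : (x : Fin (suc n)) → OldOrNew x
oldOrNew {zero}  zero    = new
oldOrNew {suc n} zero    = old zero
oldOrNew {suc n} (suc x) with oldOrNew x
... | old i = old (suc i)
... | new   = new

toOld-inject₁ : (i : Fin n) → toOld (inject₁ i) ≡ just i
toOld-inject₁ {suc n} zero    = refl
toOld-inject₁ {suc n} (suc i) rewrite toOld-inject₁ i = refl

toOld-fromℕ : ∀ n → toOld (fromℕ n) ≡ nothing
toOld-fromℕ zero    = refl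
toOld-fromℕ (suc n) rewrite toOld-fromℕ n = refl

module _ (R : Rel n) (below above : Fin n → Bool) (self : Bool) where

  glue-old-old : ∀ x y → glue R below above self (inject₁ x) (inject₁ y) ≡ R x y
  glue-old-old x y rewrite toOld-inject₁ x | toOld-inject₁ y = refl

  glue-old-new : ∀ x → glue R below above self (inject₁ x) (fromℕ n) ≡ below x
  glue-old-new x rewrite toOld-inject₁ x | toOld-fromℕ n = refl

  glue-new-old : ∀ y → glue R below above self (fromℕ n) (inject₁ y) ≡ above y
  glue-new-old y rewrite toOld-inject₁ y | toOld-fromℕ n = refl

  glue-new-new : glue R below above self (fromℕ n) (fromℕ n) ≡ self
  glue-new-new rewrite toOld-fromℕ n = refl

glue-cong : ∀ (R : Rel n) {b b′ a a′ : Fin n → Bool} s → (∀ x → b x ≡ b′ x) → (∀ x → a x ≡ a′ x) →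
  ∀ x y → glue R b a s x y ≡ glue R b′ a′ s x y
glue-cong R s eb ea x y with toOld x | toOld y
... | just u  | just v  = refl
... | just u  | nothing = eb u
... | nothing | just v  = ea v
... | nothing | nothing = refl

inject₁-==ᶠ : (x y : Fin n) → (inject₁ x ==ᶠ inject₁ y) ≡ (x ==ᶠ y)
inject₁-==ᶠ x y = T-ext (≡⇒==ᶠ ∘ Fin.inject₁-injective ∘ ==ᶠ⇒≡) (≡⇒==ᶠ ∘ cong inject₁ ∘ ==ᶠ⇒≡)

inject₁-==ᶠ-fromℕ : (x : Fin n) → (inject₁ x ==ᶠ fromℕ n) ≡ false
inject₁-==ᶠ-fromℕ x = ≢⇒==ᶠ (Fin.fromℕ≢inject₁ ∘ sym)

-- Finite posets

NaturallyLabelled : Rel n → Set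
NaturallyLabelled R = ∀ x y → R ⊢ x ≺ y → toℕ x < toℕ y

DownClosed : Rel n → (Fin n → Bool) → Set
DownClosed R d = ∀ x y → T (R x y) → T (d y) → T (d x)

downClosedᵇ : Rel n → (Fin n → Bool) → Bool
downClosedᵇ {n} R d = allᵇ (allFin n) λ x → allᵇ (allFin n) λ y → not (R x y ∧ d y ∧ not (d x))

downClosedᵇ⇔ : ∀ (R : Rel n) d → DownClosed R d ⇔ T (downClosedᵇ R d)
downClosedᵇ⇔ R d = mk⇔
  (λ closed → allᵇ-tabulate⁺ id λ x → allᵇ-tabulate⁺ id λ y → ⇒₂-intro (closed x y))
  (λ h x y → ⇒₂-elim (allᵇ-tabulate⁻ id (allᵇ-tabulate⁻ id h x) y))

ltᵇ⁺ : ∀ {R : Rel n} {x y} → R ⊢ x ≺ y → T (ltᵇ R x y)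
ltᵇ⁺ (rxy , x≢y) = ∧-intro rxy (not-intro (x≢y ∘ ==ᶠ⇒≡))

ltᵇ⁻ : ∀ {R : Rel n} {x y} → T (ltᵇ R x y) → R ⊢ x ≺ y
ltᵇ⁻ {R = R} {x} {y} h = ∧-proj₁ h , not-elim (∧-proj₂ {R x y} h) ∘ ≡⇒==ᶠ

ltᵇ-cong : ∀ {P P′ : Rel n} → (∀ x y → P x y ≡ P′ x y) → ∀ x y → ltᵇ P x y ≡ ltᵇ P′ x y
ltᵇ-cong P≗P′ x y = cong (_∧ _) (P≗P′ x y)

module _ {R : Rel n} {b a : Fin n → Bool} {s : Bool} where

  private
    G : Rel (suc n)
    G = glue R b a s

    G-oo : ∀ x y → G (inject₁ x) (inject₁ y) ≡ R x y
    G-oo = glue-old-old R b a s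

    G-on : ∀ x → G (inject₁ x) (fromℕ n) ≡ b x
    G-on = glue-old-new R b a s

    G-no : ∀ y → G (fromℕ n) (inject₁ y) ≡ a y
    G-no = glue-new-old R b a s

    G-nn : G (fromℕ n) (fromℕ n) ≡ s
    G-nn = glue-new-new R b a s

  glue-isPoset : IsPoset R → T s → (∀ i → ¬ T (a i)) → DownClosed R b → IsPoset G
  glue-isPoset P self ¬above closed = record
    { reflexive  = refl′
    ; antisym    = antisym′
    ; transitive = trans′
    }
    where
    open IsPoset P
    ¬new≤old : ∀ y → ¬ T (G (fromℕ n) (inject₁ y))
    ¬new≤old y = ¬above y ∘ subst T (G-no y)

    refl′ : ∀ x → T (G x x)
    refl′ x with oldOrNew x
    ... | old i = subst T (sym (G-oo i i)) (reflexive i)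
    ... | new   = subst T (sym G-nn) self

    antisym′ : ∀ x y → T (G x y) → T (G y x) → x ≡ y
    antisym′ x y gxy gyx with oldOrNew x | oldOrNew y
    ... | old i | old j = cong inject₁ (antisym i j (subst T (G-oo i j) gxy) (subst T (G-oo j i) gyx))
    ... | old i | new   = ⊥-elim (¬new≤old i gyx)
    ... | new   | old j = ⊥-elim (¬new≤old j gxy)
    ... | new   | new   = refl

    trans′ : ∀ x y z → T (G x y) → T (G y z) → T (G x z)
    trans′ x y z gxy gyz with oldOrNew x | oldOrNew y | oldOrNew z
    ... | old i | old j | old k =
      subst T (sym (G-oo i k)) (transitive i j k (subst T (G-oo i j) gxy) (subst T (G-oo j k) gyz))
    ... | old i | old j | new   =
      subst T (sym (G-on i)) (closed i j (subst T (G-oo i j) gxy) (subst T (G-on j) gyz))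
    ... | old i | new   | old k = ⊥-elim (¬new≤old k gyz)
    ... | old i | new   | new   = gxy
    ... | new   | old j | _     = ⊥-elim (¬new≤old j gxy)
    ... | new   | new   | old k = ⊥-elim (¬new≤old k gyz)
    ... | new   | new   | new   = gxy

  glue-natural : NaturallyLabelled R → (∀ i → ¬ T (a i)) → NaturallyLabelled G
  glue-natural natural ¬above x y (gxy , x≢y) with oldOrNew x | oldOrNew y
  ... | old i | old j = subst₂ _<_ (sym (Fin.toℕ-inject₁ i)) (sym (Fin.toℕ-inject₁ j))
                          (natural i j (subst T (G-oo i j) gxy , x≢y ∘ cong inject₁))
  ... | old i | new   = subst₂ _<_ (sym (Fin.toℕ-inject₁ i)) (sym (Fin.toℕ-fromℕ n)) (Fin.toℕ<n i)
  ... | new   | old j = ⊥-elim (¬above j (subst T (G-no j) gxy))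
  ... | new   | new   = ⊥-elim (x≢y refl)

  glue-isPoset⁻ : IsPoset G → T s × DownClosed R b
  glue-isPoset⁻ P = subst T G-nn (reflexive (fromℕ n)) , closed
    where
    open IsPoset P
    closed : DownClosed R b
    closed x y rxy by = subst T (G-on x)
      (transitive (inject₁ x) (inject₁ y) (fromℕ n) (subst T (sym (G-oo x y)) rxy) (subst T (sym (G-on y)) by))

  glue-natural⁻ : NaturallyLabelled G → ∀ i → ¬ T (a i)
  glue-natural⁻ natural i ai = ℕₚ.<-asym new<old old<new
    where
    new<old : n < toℕ i
    new<old = subst₂ _<_ (Fin.toℕ-fromℕ n) (Fin.toℕ-inject₁ i)
                (natural (fromℕ n) (inject₁ i) (subst T (sym (G-no i)) ai , Fin.fromℕ≢inject₁))
    old<new : toℕ i < n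
    old<new = Fin.toℕ<n i

ltᵇ-addAbove-old-old : ∀ (R : Rel n) d x y → ltᵇ (addAbove R d) (inject₁ x) (inject₁ y) ≡ ltᵇ R x y
ltᵇ-addAbove-old-old R d x y =
  cong₂ (λ r e → r ∧ not e) (glue-old-old R d (λ _ → false) true x y) (inject₁-==ᶠ x y)

ltᵇ-addAbove-old-new : ∀ (R : Rel n) d x → ltᵇ (addAbove R d) (inject₁ x) (fromℕ n) ≡ d x
ltᵇ-addAbove-old-new R d x = trans
  (cong₂ (λ r e → r ∧ not e) (glue-old-new R d (λ _ → false) true x) (inject₁-==ᶠ-fromℕ x))
  (∧-identityʳ (d x))

ltᵇ-addAbove-new : ∀ (R : Rel n) d y → ltᵇ (addAbove R d) (fromℕ n) y ≡ false
ltᵇ-addAbove-new R d y with oldOrNew y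
... | old j = cong (_∧ not (fromℕ _ ==ᶠ inject₁ j)) (glue-new-old R d (λ _ → false) true j)
... | new   = cong₂ (λ r e → r ∧ not e) (glue-new-new R d (λ _ → false) true) (T⇒≡true (≡⇒==ᶠ refl))

maximalᵇ : Rel n → (Fin n → Bool) → Fin n → Bool
maximalᵇ {n} R d y = d y ∧ not (anyᵇ (allFin n) λ z → ltᵇ R y z ∧ d z)

maximal-above : ∀ {R : Rel n} → IsPoset R → NaturallyLabelled R →
  ∀ {d} y → T (d y) → ∃ λ z → T (maximalᵇ R d z) × T (R y z)
maximal-above {n} {R} P natural {d} y = go y (>-wellFounded y)
  where
  -- The natural labelling embeds ≺ into the order of labels, which is well-founded upwards.
  open IsPoset P
  go : ∀ y → Acc _>_ y → T (d y) → ∃ λ z → T (maximalᵇ R d z) × T (R y z)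
  go y (acc larger) dy with anyᵇ (allFin n) (λ z → ltᵇ R y z ∧ d z) in eq
  ... | false = y , ∧-intro dy (subst (T ∘ not) (sym eq) _) , reflexive y
  ... | true with anyᵇ-tabulate⁻ id (subst T (sym eq) _)
  ...   | z , y<z∧dz with ltᵇ⁻ {R = R} (∧-proj₁ y<z∧dz)
  ...     | y≺z with go z (larger (natural y z y≺z)) (∧-proj₂ {ltᵇ R y z} y<z∧dz)
  ...       | m , max-m , Rzm = m , max-m , transitive y z m (proj₁ y≺z) Rzm

downᵇ⁺ : ∀ (R : Rel n) S {x y} → T (lookup S x) → T (R y x) → T (downᵇ R S y)
downᵇ⁺ R S {x} Sx Ryx = anyᵇ-tabulate⁺ id x (∧-intro Sx Ryx)

downᵇ⁻ : ∀ (R : Rel n) S {y} → T (downᵇ R S y) → ∃ λ x → T (lookup S x) × T (R y x)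
downᵇ⁻ R S h with anyᵇ-tabulate⁻ id h
... | x , Sx∧Ryx = x , ∧-proj₁ Sx∧Ryx , ∧-proj₂ {lookup S x} Sx∧Ryx

downᵇ-downClosed : ∀ {R : Rel n} → IsPoset R → ∀ S → DownClosed R (downᵇ R S)
downᵇ-downClosed {R = R} P S x y Rxy down-y with downᵇ⁻ R S down-y
... | z , Sz , Ryz = downᵇ⁺ R S Sz (IsPoset.transitive P x y z Rxy Ryz)

downᵇ≗⇔between : ∀ {R : Rel n} → IsPoset R → NaturallyLabelled R → ∀ {d} → DownClosed R d → ∀ S →
  (∀ i → downᵇ R S i ≡ d i) ⇔ (maximalᵇ R d ⊆ lookup S × lookup S ⊆ d)
downᵇ≗⇔between {n} {R} P natural {d} closed S = mk⇔ to from
  where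
  open IsPoset P
  to : (∀ i → downᵇ R S i ≡ d i) → maximalᵇ R d ⊆ lookup S × lookup S ⊆ d
  to down≗d = max⊆S , S⊆d
    where
    S⊆d : lookup S ⊆ d
    S⊆d i Si = subst T (down≗d i) (downᵇ⁺ R S Si (reflexive i))
    max⊆S : maximalᵇ R d ⊆ lookup S
    max⊆S i max-i with downᵇ⁻ R S (subst T (sym (down≗d i)) (∧-proj₁ max-i))
    ... | x , Sx , Rix with i Fin.≟ x
    ...   | yes refl = Sx
    ...   | no  i≢x  = ⊥-elim (not-elim (∧-proj₂ {d i} max-i)
                           (anyᵇ-tabulate⁺ id x (∧-intro (ltᵇ⁺ {R = R} (Rix , i≢x)) (S⊆d x Sx))))
  from : maximalᵇ R d ⊆ lookup S × lookup S ⊆ d → ∀ i → downᵇ R S i ≡ d i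
  from (max⊆S , S⊆d) i = T-ext down⇒d d⇒down
    where
    down⇒d : T (downᵇ R S i) → T (d i)
    down⇒d h with downᵇ⁻ R S h
    ... | x , Sx , Rix = closed i x Rix (S⊆d x Sx)
    d⇒down : T (d i) → T (downᵇ R S i)
    d⇒down di with maximal-above P natural i di
    ... | z , max-z , Riz = downᵇ⁺ R S (max⊆S z max-z) Riz

maxima : Rel n → Vec Bool n → Vec Bool n
maxima R D = Vec.tabulate (maximalᵇ R (lookup D))

does-≟-downᵇ : ∀ {R : Rel n} → IsPoset R → NaturallyLabelled R → ∀ D S →
  does (D ≟ᵛ Vec.tabulate (downᵇ R S)) ≡ downClosedᵇ R (lookup D) ∧ inIntervalᵇ (maxima R D) D S
does-≟-downᵇ {R = R} P natural D S = T-ext to from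
  where
  maxima≗ : ∀ i → lookup (maxima R D) i ≡ maximalᵇ R (lookup D) i
  maxima≗ = lookup∘tabulate (maximalᵇ R (lookup D))
  to : T (does (D ≟ᵛ Vec.tabulate (downᵇ R S))) → T (downClosedᵇ R (lookup D) ∧ inIntervalᵇ (maxima R D) D S)
  to h = ∧-intro (Equivalence.to (downClosedᵇ⇔ R (lookup D)) closed)
                 (Equivalence.from (inIntervalᵇ⇔ (maxima R D) D S) ((λ i → max⊆S i ∘ subst T (maxima≗ i)) , S⊆D))
    where
    D≗down : ∀ i → lookup D i ≡ downᵇ R S i
    D≗down = Equivalence.to (≡tabulate⇔ D (downᵇ R S)) (Equivalence.to (does⇔ (D ≟ᵛ _)) h)
    closed : DownClosed R (lookup D)
    closed x y Rxy Dy = subst T (sym (D≗down x))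
      (downᵇ-downClosed P S x y Rxy (subst T (D≗down y) Dy))
    between = Equivalence.to (downᵇ≗⇔between P natural closed S) (sym ∘ D≗down)
    max⊆S = proj₁ between
    S⊆D = proj₂ between
  from : T (downClosedᵇ R (lookup D) ∧ inIntervalᵇ (maxima R D) D S) → T (does (D ≟ᵛ Vec.tabulate (downᵇ R S)))
  from h = Equivalence.from (does⇔ (D ≟ᵛ _)) (Equivalence.from (≡tabulate⇔ D (downᵇ R S)) (sym ∘ down≗D))
    where
    closed : DownClosed R (lookup D)
    closed = Equivalence.from (downClosedᵇ⇔ R (lookup D)) (∧-proj₁ h)
    interval = Equivalence.to (inIntervalᵇ⇔ (maxima R D) D S) (∧-proj₂ {downClosedᵇ R (lookup D)} h)
    down≗D : ∀ i → downᵇ R S i ≡ lookup D i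
    down≗D = Equivalence.from (downᵇ≗⇔between P natural closed S)
      ((λ i → proj₁ interval i ∘ subst T (sym (maxima≗ i))) , proj₂ interval)

downᵇ-singleton : ∀ (R : Rel n) a y → downᵇ R (singleton a) y ≡ R y a
downᵇ-singleton R a y = T-ext
  (λ h → let (x , x=a , Ryx) = downᵇ⁻ R (singleton a) h in
         subst (T ∘ R y) (==ᶠ⇒≡ (subst T (lookup∘tabulate (_==ᶠ a) x) x=a)) Ryx)
  (downᵇ⁺ R (singleton a) (subst T (sym (lookup∘tabulate (_==ᶠ a) a)) (≡⇒==ᶠ refl)))

downᵇ-full : ∀ {R : Rel n} → IsPoset R → ∀ y → downᵇ R full y ≡ true
downᵇ-full {R = R} P y = T⇒≡true
  (downᵇ⁺ R full (subst T (sym (lookup∘tabulate (λ _ → true) y)) _) (IsPoset.reflexive P y))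

isoᵇ-cong : ∀ {m k} {P P′ : Rel m} (Q : Rel k) → (∀ x y → P x y ≡ P′ x y) → isoᵇ P Q ≡ isoᵇ P′ Q
isoᵇ-cong {m} {k} Q P≗P′ with m ℕ.≟ k
... | no _     = refl
... | yes refl = anyᵇ-cong (vecsOver (allFin m) m) λ f → cong (_ ∧_)
  (allᵇ-cong (allFin m) λ x → allᵇ-cong (allFin m) λ y → cong (_==ᵇ _) (P≗P′ x y))

-- Span's order-theoretic decision procedures do not use the semiring; it is only a module parameter.
module Decisions {c ℓ} (𝓡 : CommutativeSemiring c ℓ) where

  open Span 𝓡 using (isPosetᵇ; natLabᵇ; NatLabelled; varpi; coveredCount)
  open ≡-Reasoning


  isPosetᵇ⇔ : ∀ {R : Rel n} → IsPoset R ⇔ T (isPosetᵇ R)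
  isPosetᵇ⇔ {n} {R} = mk⇔ to from
    where
    to : IsPoset R → T (isPosetᵇ R)
    to P = ∧-intro (allᵇ-tabulate⁺ id reflexive) (∧-intro
      (allᵇ-tabulate⁺ id λ x → allᵇ-tabulate⁺ id λ y →
         ⇒₂-intro λ Rxy Ryx → ≡⇒==ᶠ (antisym x y Rxy Ryx))
      (allᵇ-tabulate⁺ id λ x → allᵇ-tabulate⁺ id λ y → allᵇ-tabulate⁺ id λ z →
         ⇒₂-intro (transitive x y z)))
      where open IsPoset P
    from : T (isPosetᵇ R) → IsPoset R
    from h = record
      { reflexive  = allᵇ-tabulate⁻ id reflᵇ
      ; antisym    = λ x y Rxy Ryx →
          ==ᶠ⇒≡ (⇒₂-elim (allᵇ-tabulate⁻ id (allᵇ-tabulate⁻ id antisymᵇ x) y) Rxy Ryx)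
      ; transitive = λ x y z →
          ⇒₂-elim (allᵇ-tabulate⁻ id (allᵇ-tabulate⁻ id (allᵇ-tabulate⁻ id transitiveᵇ x) y) z)
      }
      where
      ∀ᵇ : (Fin n → Bool) → Bool
      ∀ᵇ = allᵇ (allFin n)
      reflᵇ : T (∀ᵇ λ x → R x x)
      reflᵇ = ∧-proj₁ h
      rest = ∧-proj₂ {∀ᵇ λ x → R x x} h
      antisymᵇ : T (∀ᵇ λ x → ∀ᵇ λ y → not (R x y ∧ R y x ∧ not (x ==ᶠ y)))
      antisymᵇ = ∧-proj₁ rest
      transitiveᵇ : T (∀ᵇ λ x → ∀ᵇ λ y → ∀ᵇ λ z → not (R x y ∧ R y z ∧ not (R x z)))
      transitiveᵇ = ∧-proj₂ {∀ᵇ λ x → ∀ᵇ λ y → not (R x y ∧ R y x ∧ not (x ==ᶠ y))} rest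

  natLabᵇ⇔ : ∀ {R : Rel n} → NaturallyLabelled R ⇔ NatLabelled R
  natLabᵇ⇔ {R = R} = mk⇔
    (λ natural → allᵇ-tabulate⁺ id λ x → allᵇ-tabulate⁺ id λ y →
       ⇒-intro (ℕₚ.<⇒<ᵇ ∘ natural x y ∘ ltᵇ⁻ {R = R}))
    (λ h x y x≺y →
       ℕₚ.<ᵇ⇒< _ _ (⇒-elim (allᵇ-tabulate⁻ id (allᵇ-tabulate⁻ id h x) y) (ltᵇ⁺ {R = R} x≺y)))

  isExtensionᵇ-glue : ∀ {R : Rel n} → IsPoset R → NaturallyLabelled R → ∀ (B A : Vec Bool n) s →
    let G = glue R (lookup B) (lookup A) s in
    (isPosetᵇ G ∧ natLabᵇ G) ≡ s ∧ (does (A ≟ᵛ ∅) ∧ downClosedᵇ R (lookup B))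
  isExtensionᵇ-glue {n} {R} P natural B A s = T-ext to from
    where
    G = glue R (lookup B) (lookup A) s
    A-empty⇔ : T (does (A ≟ᵛ ∅)) ⇔ (∀ i → lookup A i ≡ false)
    A-empty⇔ = ≡tabulate⇔ A (λ _ → false) ⇔-∘ does⇔ (A ≟ᵛ _)
    to : T (isPosetᵇ G ∧ natLabᵇ G) → T (s ∧ (does (A ≟ᵛ ∅) ∧ downClosedᵇ R (lookup B)))
    to h = ∧-intro {s} self (∧-intro {does (A ≟ᵛ _)} (Equivalence.from A-empty⇔ (¬T⇒≡false ∘ ¬above))
                                                  (Equivalence.to (downClosedᵇ⇔ R (lookup B)) closed))
      where
      self×closed = glue-isPoset⁻ (Equivalence.from isPosetᵇ⇔ (∧-proj₁ h))
      self = proj₁ self×closed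
      closed = proj₂ self×closed
      ¬above = glue-natural⁻ (Equivalence.from natLabᵇ⇔ (∧-proj₂ {isPosetᵇ G} h))
    from : T (s ∧ (does (A ≟ᵛ ∅) ∧ downClosedᵇ R (lookup B))) → T (isPosetᵇ G ∧ natLabᵇ G)
    from h = ∧-intro {isPosetᵇ G} (Equivalence.to isPosetᵇ⇔ (glue-isPoset P self ¬above closed))
                     (Equivalence.to natLabᵇ⇔ (glue-natural natural ¬above))
      where
      self = ∧-proj₁ h
      rest = ∧-proj₂ {s} h
      ¬above : ∀ i → ¬ T (lookup A i)
      ¬above i = subst T (Equivalence.to A-empty⇔ (∧-proj₁ rest) i)
      closed = Equivalence.from (downClosedᵇ⇔ R (lookup B)) (∧-proj₂ {does (A ≟ᵛ ∅)} rest)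

  varpi-cong : ∀ {P P′ : Rel (suc n)} → (∀ x y → P x y ≡ P′ x y) → varpi P ≡ varpi P′
  varpi-cong {n} P≗P′ = countᵇ-cong (suc n) λ y → ltᵇ-cong P≗P′ y (fromℕ n)

  coveredCount-cong : ∀ {P P′ : Rel (suc n)} → (∀ x y → P x y ≡ P′ x y) → coveredCount P ≡ coveredCount P′
  coveredCount-cong {n} P≗P′ = countᵇ-cong (suc n) λ y → cong₂ _∧_ (ltᵇ-cong P≗P′ y (fromℕ n))
    (cong not (anyᵇ-cong (allFin (suc n)) λ z →
      cong₂ _∧_ (ltᵇ-cong P≗P′ y z) (ltᵇ-cong P≗P′ z (fromℕ n))))

  varpi-addAbove : ∀ (R : Rel n) d → varpi (addAbove R d) ≡ countᵇ n d
  varpi-addAbove {n} R d = begin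
    varpi G
      ≡⟨ countᵇ-last n (λ y → ltᵇ G y (fromℕ n)) ⟩
    countᵇ n (λ y → ltᵇ G (inject₁ y) (fromℕ n)) ℕ.+ fromBool (ltᵇ G (fromℕ n) (fromℕ n))
      ≡⟨ cong₂ ℕ._+_ (countᵇ-cong n (ltᵇ-addAbove-old-new R d)) (cong fromBool (ltᵇ-addAbove-new R d (fromℕ n))) ⟩
    countᵇ n d ℕ.+ 0
      ≡⟨ ℕₚ.+-identityʳ _ ⟩
    countᵇ n d ∎
    where
    G = addAbove R d

  coveredCount-addAbove : ∀ (R : Rel n) d → coveredCount (addAbove R d) ≡ countᵇ n (maximalᵇ R d)
  coveredCount-addAbove {n} R d = begin
    coveredCount (addAbove R d)
      ≡⟨ countᵇ-last n covered ⟩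
    countᵇ n (covered ∘ inject₁) ℕ.+ fromBool (covered (fromℕ n))
      ≡⟨ cong₂ ℕ._+_ (countᵇ-cong n covered-old) (cong fromBool covered-new) ⟩
    countᵇ n (maximalᵇ R d) ℕ.+ 0
      ≡⟨ ℕₚ.+-identityʳ _ ⟩
    countᵇ n (maximalᵇ R d) ∎
    where
    G = addAbove R d
    between : Fin (suc n) → Fin (suc n) → Bool
    between y z = ltᵇ G y z ∧ ltᵇ G z (fromℕ n)
    covered : Fin (suc n) → Bool
    covered y = ltᵇ G y (fromℕ n) ∧ not (anyᵇ (allFin (suc n)) (between y))
    between-old : ∀ y z → between (inject₁ y) (inject₁ z) ≡ ltᵇ R y z ∧ d z
    between-old y z = cong₂ _∧_ (ltᵇ-addAbove-old-old R d y z) (ltᵇ-addAbove-old-new R d z)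
    between-new : ∀ y → ¬ T (between y (fromℕ n))
    between-new y = subst T (ltᵇ-addAbove-new R d (fromℕ n)) ∘ ∧-proj₂ {ltᵇ G y (fromℕ n)}
    old-witness : ∀ y z → T (between (inject₁ y) z) → T (anyᵇ (allFin n) λ z → ltᵇ R y z ∧ d z)
    old-witness y z h with oldOrNew z
    ... | old j = anyᵇ-tabulate⁺ id j (subst T (between-old y j) h)
    ... | new   = ⊥-elim (between-new (inject₁ y) h)
    any-between : ∀ y → anyᵇ (allFin (suc n)) (between (inject₁ y)) ≡ anyᵇ (allFin n) (λ z → ltᵇ R y z ∧ d z)
    any-between y = T-ext
      (λ h → let (z , hz) = anyᵇ-tabulate⁻ id h in old-witness y z hz)
      (λ h → let (j , hj) = anyᵇ-tabulate⁻ id h in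
             anyᵇ-tabulate⁺ id (inject₁ j) (subst T (sym (between-old y j)) hj))
    covered-old : ∀ y → covered (inject₁ y) ≡ maximalᵇ R d y
    covered-old y = cong₂ (λ u v → u ∧ not v) (ltᵇ-addAbove-old-new R d y) (any-between y)
    covered-new : covered (fromℕ n) ≡ false
    covered-new = cong (_∧ not (anyᵇ (allFin (suc n)) (between (fromℕ n)))) (ltᵇ-addAbove-new R d (fromℕ n))

module Sums {c ℓ} (𝓡 : CommutativeSemiring c ℓ) where

  open CommutativeSemiring 𝓡
    renaming (refl to ≈-refl; sym to ≈-sym; trans to ≈-trans; zero to *-zero)
  open Span 𝓡
  open import Algebra.Properties.CommutativeSemigroup +-commutativeSemigroup using (interchange; x∙yz≈y∙xz)
  open import Relation.Binary.Reasoning.Setoid setoid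

  Σ-cong : ∀ (xs : List X) {f g : X → Carrier} → (∀ x → f x ≈ g x) → Σ[ xs ] f ≈ Σ[ xs ] g
  Σ-cong []       _   = ≈-refl
  Σ-cong (x ∷ xs) f≈g = +-cong (f≈g x) (Σ-cong xs f≈g)

  Σ-++ : ∀ (xs ys : List X) f → Σ[ xs ++ ys ] f ≈ Σ[ xs ] f + Σ[ ys ] f
  Σ-++ []       ys f = ≈-sym (+-identityˡ _)
  Σ-++ (x ∷ xs) ys f = ≈-trans (+-congˡ (Σ-++ xs ys f)) (≈-sym (+-assoc _ _ _))

  Σ-concatMap : ∀ (h : X → List Y) xs f → Σ[ concatMap h xs ] f ≈ Σ[ xs ] (λ x → Σ[ h x ] f)
  Σ-concatMap h []       f = ≈-refl
  Σ-concatMap h (x ∷ xs) f = ≈-trans (Σ-++ (h x) (concatMap h xs) f) (+-congˡ (Σ-concatMap h xs f))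

  Σ-map : ∀ (g : X → Y) xs f → Σ[ map g xs ] f ≡ Σ[ xs ] (f ∘ g)
  Σ-map g xs f = foldr-map _ g 0# xs

  Σ-zero : ∀ (xs : List X) → Σ[ xs ] (λ _ → 0#) ≈ 0#
  Σ-zero []       = ≈-refl
  Σ-zero (x ∷ xs) = ≈-trans (+-identityˡ _) (Σ-zero xs)

  Σ-+ : ∀ (xs : List X) f g → Σ[ xs ] (λ x → f x + g x) ≈ Σ[ xs ] f + Σ[ xs ] g
  Σ-+ []       f g = ≈-sym (+-identityˡ 0#)
  Σ-+ (x ∷ xs) f g = ≈-trans (+-congˡ (Σ-+ xs f g)) (interchange _ _ _ _)

  Σ-swap : ∀ (xs : List X) (ys : List Y) (f : X → Y → Carrier) →
    Σ[ xs ] (λ x → Σ[ ys ] (f x)) ≈ Σ[ ys ] (λ y → Σ[ xs ] (λ x → f x y))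
  Σ-swap []       ys f = ≈-sym (Σ-zero ys)
  Σ-swap (x ∷ xs) ys f = ≈-trans (+-congˡ (Σ-swap xs ys f)) (≈-sym (Σ-+ ys (f x) _))

  if-cong : ∀ b {x y} → x ≈ y → (if b then x else 0#) ≈ (if b then y else 0#)
  if-cong true  x≈y = x≈y
  if-cong false _   = ≈-refl

  if-∧ : ∀ a b (x : Carrier) → (if a ∧ b then x else 0#) ≡ (if a then (if b then x else 0#) else 0#)
  if-∧ true  b x = refl
  if-∧ false b x = refl

  if-swap : ∀ a b (x : Carrier) →
    (if a then (if b then x else 0#) else 0#) ≡ (if b then (if a then x else 0#) else 0#)
  if-swap a b x = trans (sym (if-∧ a b x)) (trans (cong (λ e → if e then x else 0#) (∧-comm a b)) (if-∧ b a x))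

  Σ-if : ∀ (xs : List X) b f → Σ[ xs ] (λ x → if b then f x else 0#) ≈ (if b then Σ[ xs ] f else 0#)
  Σ-if xs true  f = ≈-refl
  Σ-if xs false f = Σ-zero xs

  Σ-filter : ∀ {p : X → Bool} (P? : ∀ x → Dec (T (p x))) xs f →
    Σ[ filter P? xs ] f ≈ Σ[ xs ] (λ x → if p x then f x else 0#)
  Σ-filter P? []       f = ≈-refl
  Σ-filter P? (x ∷ xs) f with P? x
  ... | yes px rewrite T⇒≡true px   = +-congˡ (Σ-filter P? xs f)
  ... | no ¬px rewrite ¬T⇒≡false ¬px = ≈-trans (Σ-filter P? xs f) (≈-sym (+-identityˡ _))

  Σ-allFin-suc : ∀ n (f : Fin (suc n) → Carrier) → Σ[ allFin (suc n) ] f ≡ f zero + Σ[ allFin n ] (f ∘ suc)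
  Σ-allFin-suc n f = trans (cong (Σ[_] f) (allFin-suc n)) (cong (f zero +_) (Σ-map suc (allFin n) f))

  Σ-subsets-suc : ∀ n (g : Vec Bool (suc n) → Carrier) →
    Σ[ subsets (suc n) ] g ≈ Σ[ subsets n ] (λ v → g (true ∷ v) + g (false ∷ v))
  Σ-subsets-suc n g = ≈-trans (Σ-concatMap _ (subsets n) g) (Σ-cong (subsets n) λ v → +-congˡ (+-identityʳ _))

  Σ-subsets-≟ : ∀ (P : Vec Bool n) (g : Vec Bool n → Carrier) →
    Σ[ subsets n ] (λ S → if does (S ≟ᵛ P) then g S else 0#) ≈ g P
  Σ-subsets-≟ [] g = +-identityʳ _
  Σ-subsets-≟ {suc n} (true ∷ P) g = begin
    Σ[ subsets (suc n) ] (λ S → if does (S ≟ᵛ (true ∷ P)) then g S else 0#)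
      ≈⟨ Σ-subsets-suc n _ ⟩
    Σ[ subsets n ] (λ v → (if does (v ≟ᵛ P) then g (true ∷ v) else 0#) + 0#)
      ≈⟨ Σ-cong (subsets n) (λ v → +-identityʳ _) ⟩
    Σ[ subsets n ] (λ v → if does (v ≟ᵛ P) then g (true ∷ v) else 0#)
      ≈⟨ Σ-subsets-≟ P (g ∘ (true ∷_)) ⟩
    g (true ∷ P) ∎
  Σ-subsets-≟ {suc n} (false ∷ P) g = begin
    Σ[ subsets (suc n) ] (λ S → if does (S ≟ᵛ (false ∷ P)) then g S else 0#)
      ≈⟨ Σ-subsets-suc n _ ⟩
    Σ[ subsets n ] (λ v → 0# + (if does (v ≟ᵛ P) then g (false ∷ v) else 0#))
      ≈⟨ Σ-cong (subsets n) (λ v → +-identityˡ _) ⟩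
    Σ[ subsets n ] (λ v → if does (v ≟ᵛ P) then g (false ∷ v) else 0#)
      ≈⟨ Σ-subsets-≟ P (g ∘ (false ∷_)) ⟩
    g (false ∷ P) ∎

  Σ-singletons : ∀ (S : Vec Bool n) →
    Σ[ allFin n ] (λ a → if does (S ≟ᵛ singleton a) then 1# else 0#) ≈ (if card S ℕ.≡ᵇ 1 then 1# else 0#)
  Σ-singletons [] = ≈-refl
  Σ-singletons {suc n} (true ∷ S) = begin
    Σ[ allFin (suc n) ] (λ a → if does ((true ∷ S) ≟ᵛ singleton a) then 1# else 0#)
      ≡⟨ Σ-allFin-suc n _ ⟩
    (if does (S ≟ᵛ ∅) then 1# else 0#) + Σ[ allFin n ] (λ _ → 0#)
      ≈⟨ ≈-trans (+-congˡ (Σ-zero (allFin n))) (+-identityʳ _) ⟩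
    (if does (S ≟ᵛ ∅) then 1# else 0#)
      ≡⟨ cong (λ b → if b then 1# else 0#) (does-≟-∅ S) ⟩
    (if card S ℕ.≡ᵇ 0 then 1# else 0#)
      ≡⟨ cong (λ c → if c ℕ.≡ᵇ 1 then 1# else 0#) (sym (card-∷ true S)) ⟩
    (if card (true ∷ S) ℕ.≡ᵇ 1 then 1# else 0#) ∎
  Σ-singletons {suc n} (false ∷ S) = begin
    Σ[ allFin (suc n) ] (λ a → if does ((false ∷ S) ≟ᵛ singleton a) then 1# else 0#)
      ≡⟨ Σ-allFin-suc n _ ⟩
    0# + Σ[ allFin n ] (λ a → if does ((false ∷ S) ≟ᵛ singleton (suc a)) then 1# else 0#)
      ≈⟨ +-identityˡ _ ⟩
    Σ[ allFin n ] (λ a → if does ((false ∷ S) ≟ᵛ singleton (suc a)) then 1# else 0#)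
      ≈⟨ Σ-cong (allFin n) (λ a →
           reflexive (cong (λ v → if does ((false ∷ S) ≟ᵛ v) then 1# else 0#) (singleton-suc a))) ⟩
    Σ[ allFin n ] (λ a → if does (S ≟ᵛ singleton a) then 1# else 0#)
      ≈⟨ Σ-singletons S ⟩
    (if card S ℕ.≡ᵇ 1 then 1# else 0#)
      ≡⟨ cong (λ c → if c ℕ.≡ᵇ 1 then 1# else 0#) (sym (card-∷ false S)) ⟩
    (if card (false ∷ S) ℕ.≡ᵇ 1 then 1# else 0#) ∎

  Σ-upTo-suc : ∀ m (h : ℕ → Carrier) → Σ[ upTo (suc m) ] h ≡ h 0 + Σ[ upTo m ] (h ∘ suc)
  Σ-upTo-suc m h = cong (h 0 +_) (trans (cong (Σ[_] h) (sym (map-applyUpTo id suc m))) (Σ-map suc (upTo m) h))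

  Σ-upTo-∷ʳ : ∀ m (h : ℕ → Carrier) → Σ[ upTo (suc m) ] h ≈ Σ[ upTo m ] h + h m
  Σ-upTo-∷ʳ m h = begin
    Σ[ upTo (suc m) ] h              ≡⟨ cong (Σ[_] h) (sym (upTo-∷ʳ m)) ⟩
    Σ[ upTo m ++ [ m ] ] h           ≈⟨ Σ-++ (upTo m) [ m ] h ⟩
    Σ[ upTo m ] h + (h m + 0#)       ≈⟨ +-congˡ (+-identityʳ _) ⟩
    Σ[ upTo m ] h + h m              ∎

  open import Algebra.Properties.Monoid.Mult +-monoid using (×-homo-+; ×-congʳ) renaming (_×_ to _×ₘ_)

  ·≡×ₘ : ∀ k x → k · x ≡ k ×ₘ x
  ·≡×ₘ zero    x = refl
  ·≡×ₘ (suc k) x = cong (x +_) (·≡×ₘ k x)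

  ·-congʳ : ∀ k {x y} → x ≈ y → k · x ≈ k · y
  ·-congʳ k {x} {y} x≈y = begin
    k · x  ≡⟨ ·≡×ₘ k x ⟩
    k ×ₘ x ≈⟨ ×-congʳ k x≈y ⟩
    k ×ₘ y ≡⟨ sym (·≡×ₘ k y) ⟩
    k · y  ∎

  ·-homo-+ : ∀ k l x → (k ℕ.+ l) · x ≈ k · x + l · x
  ·-homo-+ k l x = begin
    (k ℕ.+ l) · x   ≡⟨ ·≡×ₘ (k ℕ.+ l) x ⟩
    (k ℕ.+ l) ×ₘ x  ≈⟨ ×-homo-+ x k l ⟩
    k ×ₘ x + l ×ₘ x ≡⟨ sym (cong₂ _+_ (·≡×ₘ k x) (·≡×ₘ l x)) ⟩
    k · x + l · x   ∎

  binomialSum : ℕ → (ℕ → Carrier) → Carrier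
  binomialSum k g = Σ[ upTo (suc k) ] (λ i → (k C i) · g i)

  binomialSum-cong : ∀ k {g h : ℕ → Carrier} → (∀ i → g i ≈ h i) → binomialSum k g ≈ binomialSum k h
  binomialSum-cong k g≈h = Σ-cong (upTo (suc k)) λ i → ·-congʳ (k C i) (g≈h i)

  binomialSum-suc : ∀ k (g : ℕ → Carrier) → binomialSum (suc k) g ≈ binomialSum k (g ∘ suc) + binomialSum k g
  binomialSum-suc k g = begin
    binomialSum (suc k) g
      ≡⟨ Σ-upTo-suc (suc k) _ ⟩
    (g 0 + 0#) + Σ[ upTo (suc k) ] (λ i → (suc k C suc i) · g (suc i))
      ≈⟨ +-cong (+-identityʳ _) (Σ-cong (upTo (suc k)) pascal) ⟩
    g 0 + Σ[ upTo (suc k) ] (λ i → (k C i) · g (suc i) + (k C suc i) · g (suc i))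
      ≈⟨ +-congˡ (Σ-+ (upTo (suc k)) _ _) ⟩
    g 0 + (binomialSum k (g ∘ suc) + shifted)
      ≈⟨ x∙yz≈y∙xz (g 0) _ _ ⟩
    binomialSum k (g ∘ suc) + (g 0 + shifted)
      ≈⟨ +-congˡ (+-cong (≈-sym (+-identityʳ _)) shifted≈) ⟩
    binomialSum k (g ∘ suc) + ((g 0 + 0#) + Σ[ upTo k ] (λ i → (k C suc i) · g (suc i)))
      ≡⟨ cong (binomialSum k (g ∘ suc) +_) (sym (Σ-upTo-suc k _)) ⟩
    binomialSum k (g ∘ suc) + binomialSum k g ∎
    where
    shifted : Carrier
    shifted = Σ[ upTo (suc k) ] (λ i → (k C suc i) · g (suc i))
    pascal : ∀ i → (suc k C suc i) · g (suc i) ≈ (k C i) · g (suc i) + (k C suc i) · g (suc i)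
    pascal i = ≈-trans (reflexive (cong (_· g (suc i)) (sym (nCk+nC[k+1]≡[n+1]C[k+1] k i))))
                       (·-homo-+ (k C i) (k C suc i) (g (suc i)))
    shifted≈ : shifted ≈ Σ[ upTo k ] (λ i → (k C suc i) · g (suc i))
    shifted≈ = begin
      shifted                                                        ≈⟨ Σ-upTo-∷ʳ k _ ⟩
      Σ[ upTo k ] (λ i → (k C suc i) · g (suc i)) + (k C suc k) · g (suc k)
        ≡⟨ cong (λ m → Σ[ upTo k ] (λ i → (k C suc i) · g (suc i)) + m · g (suc k)) (k>n⇒nCk≡0 (ℕₚ.n<1+n k)) ⟩
      Σ[ upTo k ] (λ i → (k C suc i) · g (suc i)) + 0#               ≈⟨ +-identityʳ _ ⟩
      Σ[ upTo k ] (λ i → (k C suc i) · g (suc i))                    ∎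

  Σ-interval : ∀ (a b : Vec Bool n) (f : ℕ → Carrier) → lookup a ⊆ lookup b →
    Σ[ subsets n ] (λ S → if inIntervalᵇ a b S then f (card S) else 0#)
      ≈ binomialSum (card b ∸ card a) (λ i → f (card a ℕ.+ i))
  Σ-interval [] [] f _ = ≈-sym (+-identityʳ _)
  Σ-interval {suc n} (x ∷ a) (y ∷ b) f a⊆b rewrite card-∷ x a | card-∷ y b = begin
    Σ[ subsets (suc n) ] (λ S → if inIntervalᵇ (x ∷ a) (y ∷ b) S then f (card S) else 0#)
      ≈⟨ Σ-subsets-suc n _ ⟩
    Σ[ subsets n ] (λ v → term (true ∷ v) + term (false ∷ v))
      ≈⟨ Σ-cong (subsets n) (λ v → +-cong (reflexive (term-∷ true v)) (reflexive (term-∷ false v))) ⟩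
    Σ[ subsets n ] (λ v → head-term x y true v + head-term x y false v)
      ≈⟨ by-head x y (a⊆b zero) ⟩
    binomialSum ((fromBool y ℕ.+ card b) ∸ (fromBool x ℕ.+ card a)) (λ i → f ((fromBool x ℕ.+ card a) ℕ.+ i)) ∎
    where
    term : Vec Bool (suc n) → Carrier
    term S = if inIntervalᵇ (x ∷ a) (y ∷ b) S then f (card S) else 0#
    head-term : Bool → Bool → Bool → Vec Bool n → Carrier
    head-term x y z v = if ((not x ∨ z) ∧ (not z ∨ y)) ∧ inIntervalᵇ a b v then f (fromBool z ℕ.+ card v) else 0#
    term-∷ : ∀ z v → term (z ∷ v) ≡ head-term x y z v
    term-∷ z v = cong₂ (λ e k → if e then f k else 0#) (inIntervalᵇ-∷ x y z a b v) (card-∷ z v)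
    a⊆b′ : lookup a ⊆ lookup b
    a⊆b′ = a⊆b ∘ suc
    by-head : ∀ x y → (T x → T y) →
      Σ[ subsets n ] (λ v → head-term x y true v + head-term x y false v)
        ≈ binomialSum ((fromBool y ℕ.+ card b) ∸ (fromBool x ℕ.+ card a)) (λ i → f ((fromBool x ℕ.+ card a) ℕ.+ i))
    by-head true  true  _   = ≈-trans (Σ-cong (subsets n) λ v → +-identityʳ _) (Σ-interval a b (f ∘ suc) a⊆b′)
    by-head false false _   = ≈-trans (Σ-cong (subsets n) λ v → +-identityˡ _) (Σ-interval a b f a⊆b′)
    by-head true  false x⇒y = ⊥-elim (x⇒y _)
    by-head false true  _   = begin
      Σ[ subsets n ] (λ v → head-term false true true v + head-term false true false v)
        ≈⟨ Σ-+ (subsets n) _ _ ⟩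
      Σ[ subsets n ] (λ v → if inIntervalᵇ a b v then f (suc (card v)) else 0#)
        + Σ[ subsets n ] (λ v → if inIntervalᵇ a b v then f (card v) else 0#)
        ≈⟨ +-cong (Σ-interval a b (f ∘ suc) a⊆b′) (Σ-interval a b f a⊆b′) ⟩
      binomialSum (card b ∸ card a) (λ i → f (suc (card a ℕ.+ i))) + binomialSum (card b ∸ card a) g
        ≈⟨ +-congʳ (binomialSum-cong (card b ∸ card a) λ i → reflexive (cong f (sym (ℕₚ.+-suc (card a) i)))) ⟩
      binomialSum (card b ∸ card a) (g ∘ suc) + binomialSum (card b ∸ card a) g
        ≈⟨ binomialSum-suc (card b ∸ card a) g ⟨
      binomialSum (suc (card b ∸ card a)) g
        ≡⟨ cong (λ k → binomialSum k g) (sym (ℕₚ.+-∸-assoc 1 (card-mono {a = a} {b} a⊆b′))) ⟩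
      binomialSum (suc (card b) ∸ card a) g ∎
      where
      g : ℕ → Carrier
      g i = f (card a ℕ.+ i)

module Expansions {c ℓ} (𝓡 : CommutativeSemiring c ℓ) where

  open CommutativeSemiring 𝓡
    renaming (refl to ≈-refl; sym to ≈-sym; trans to ≈-trans; zero to *-zero)
  open Span 𝓡
  open Sums 𝓡
  open Decisions 𝓡
  open import Relation.Binary.Reasoning.Setoid setoid

  coeff-map : ∀ {m k} (Q : Rel k) (xs : List X) (a : X → Carrier) (P : X → Rel m) →
    coeff Q (map (λ x → (a x , (m , P x))) xs) ≈ Σ[ xs ] (λ x → if isoᵇ (P x) Q then a x else 0#)
  coeff-map Q []       a P = ≈-refl
  coeff-map Q (x ∷ xs) a P with isoᵇ (P x) Q
  ... | true  = +-congˡ (coeff-map Q xs a P)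
  ... | false = ≈-trans (coeff-map Q xs a P) (≈-sym (+-identityˡ _))

  coeff-M : ∀ (s t : ℕ → Carrier) (R : Rel n) {k} (Q : Rel k) →
    coeff Q (M s t R) ≈ Σ[ subsets n ] (λ S → if isoᵇ (B R S) Q then t (card S) * s (n ∸ card S) else 0#)
  coeff-M {n} s t R Q = coeff-map Q (subsets n) _ (B R)

  B₊≋M : ∀ (s t : ℕ → Carrier) → s 0 ≈ 1# → (∀ i → s (suc i) ≈ 0#) → (∀ j → t j ≈ 1#) →
    ∀ (R : Rel n) → IsPoset R → [ (1# , (suc n , B₊ R)) ] ≋ M s t R
  B₊≋M {n} s t s₀ s₊ t₁ R P m Q = ≈-sym (begin
    coeff Q (M s t R)
      ≈⟨ coeff-M s t R Q ⟩
    Σ[ subsets n ] (λ S → if isoᵇ (B R S) Q then t (card S) * s (n ∸ card S) else 0#)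
      ≈⟨ Σ-cong (subsets n) (λ S → if-cong (isoᵇ (B R S) Q) (weight S)) ⟩
    Σ[ subsets n ] (λ S → if isoᵇ (B R S) Q then (if does (S ≟ᵛ full) then 1# else 0#) else 0#)
      ≈⟨ Σ-cong (subsets n) (λ S → reflexive (if-swap (isoᵇ (B R S) Q) _ 1#)) ⟩
    Σ[ subsets n ] (λ S → if does (S ≟ᵛ full) then (if isoᵇ (B R S) Q then 1# else 0#) else 0#)
      ≈⟨ Σ-subsets-≟ full (λ S → if isoᵇ (B R S) Q then 1# else 0#) ⟩
    (if isoᵇ (B R full) Q then 1# else 0#)
      ≡⟨ cong (λ b → if b then 1# else 0#) (isoᵇ-cong Q (glue-cong R true (downᵇ-full P) (λ _ → refl))) ⟩
    (if isoᵇ (B₊ R) Q then 1# else 0#)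
      ≈⟨ if-cong (isoᵇ (B₊ R) Q) (≈-sym (+-identityʳ 1#)) ⟩
    coeff Q [ (1# , (suc n , B₊ R)) ] ∎)
    where
    s-weight : ∀ {k} (S : Vec Bool k) → s (k ∸ card S) ≈ (if does (S ≟ᵛ full) then 1# else 0#)
    s-weight []                  = s₀
    s-weight {suc k} (true  ∷ S) = ≈-trans (reflexive (cong (λ c → s (suc k ∸ c)) (card-∷ true S))) (s-weight S)
    s-weight {suc k} (false ∷ S) rewrite card-∷ false S | ℕₚ.+-∸-assoc 1 (card≤n S) = s₊ (k ∸ card S)
    weight : ∀ S → t (card S) * s (n ∸ card S) ≈ (if does (S ≟ᵛ full) then 1# else 0#)
    weight S = ≈-trans (*-cong (t₁ _) (s-weight S)) (*-identityˡ _)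

  N≋M : ∀ (s t : ℕ → Carrier) → t 1 ≈ 1# → (∀ i → ¬ (i ≡ 1) → t i ≈ 0#) → (∀ j → s j ≈ 1#) →
    ∀ (R : Rel n) → N R ≋ M s t R
  N≋M {n} s t t₁ t₀ s₁ R m Q = ≈-sym (begin
    coeff Q (M s t R)
      ≈⟨ coeff-M s t R Q ⟩
    Σ[ subsets n ] (λ S → if isoᵇ (B R S) Q then t (card S) * s (n ∸ card S) else 0#)
      ≈⟨ Σ-cong (subsets n) (λ S → if-cong (isoᵇ (B R S) Q) (weight S)) ⟩
    Σ[ subsets n ] (λ S → if isoᵇ (B R S) Q then Σ[ allFin n ] (is-singleton S) else 0#)
      ≈⟨ Σ-cong (subsets n) (λ S → ≈-sym (Σ-if (allFin n) (isoᵇ (B R S) Q) (is-singleton S))) ⟩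
    Σ[ subsets n ] (λ S → Σ[ allFin n ] (λ a → if isoᵇ (B R S) Q then is-singleton S a else 0#))
      ≈⟨ Σ-swap (subsets n) (allFin n) _ ⟩
    Σ[ allFin n ] (λ a → Σ[ subsets n ] (λ S → if isoᵇ (B R S) Q then is-singleton S a else 0#))
      ≈⟨ Σ-cong (allFin n) (λ a → Σ-cong (subsets n) (λ S → reflexive (if-swap (isoᵇ (B R S) Q) _ 1#))) ⟩
    Σ[ allFin n ] (λ a → Σ[ subsets n ] (λ S →
      if does (S ≟ᵛ singleton a) then (if isoᵇ (B R S) Q then 1# else 0#) else 0#))
      ≈⟨ Σ-cong (allFin n) (λ a → Σ-subsets-≟ (singleton a) (λ S → if isoᵇ (B R S) Q then 1# else 0#)) ⟩
    Σ[ allFin n ] (λ a → if isoᵇ (B R (singleton a)) Q then 1# else 0#)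
      ≈⟨ Σ-cong (allFin n) (λ a → reflexive (cong (λ b → if b then 1# else 0#)
           (isoᵇ-cong Q (glue-cong R true (downᵇ-singleton R a) (λ _ → refl))))) ⟩
    Σ[ allFin n ] (λ a → if isoᵇ (addLeaf R a) Q then 1# else 0#)
      ≈⟨ coeff-map Q (allFin n) (λ _ → 1#) (addLeaf R) ⟨
    coeff Q (N R) ∎)
    where
    is-singleton : Vec Bool n → Fin n → Carrier
    is-singleton S a = if does (S ≟ᵛ singleton a) then 1# else 0#
    t-indicator : ∀ k → t k ≈ (if k ℕ.≡ᵇ 1 then 1# else 0#)
    t-indicator 0             = t₀ 0 λ ()
    t-indicator 1             = t₁
    t-indicator (suc (suc k)) = t₀ (suc (suc k)) λ ()
    weight : ∀ S → t (card S) * s (n ∸ card S) ≈ Σ[ allFin n ] (is-singleton S)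
    weight S = ≈-trans (*-cong (t-indicator (card S)) (s₁ _)) (≈-trans (*-identityʳ _) (≈-sym (Σ-singletons S)))

  module _ (t : ℕ → Carrier) {R : Rel n} (P : IsPoset R) (natural : NaturallyLabelled R) {m} (Q : Rel m) where

    extensionWeight : Rel (suc n) → Carrier
    extensionWeight G = if isoᵇ G Q then lam t (varpi G) (coveredCount G) else 0#

    extensionWeight-cong : ∀ {G G′ : Rel (suc n)} → (∀ x y → G x y ≡ G′ x y) →
      extensionWeight G ≡ extensionWeight G′
    extensionWeight-cong {G} {G′} G≗G′
      rewrite isoᵇ-cong {P = G} {G′} Q G≗G′ | varpi-cong G≗G′ | coveredCount-cong G≗G′ = refl

    w≈Σ-downClosed : w t R Q ≈ Σ[ subsets n ] (λ D →
      if downClosedᵇ R (lookup D) then extensionWeight (addAbove R (lookup D)) else 0#)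
    w≈Σ-downClosed = begin
      w t R Q
        ≈⟨ Σ-filter {p = λ G → isoᵇ G Q} _ (extensions R) _ ⟩
      Σ[ extensions R ] extensionWeight
        ≈⟨ Σ-filter {p = isExtensionᵇ} _ (concatMap gluings (subsets n)) extensionWeight ⟩
      Σ[ concatMap gluings (subsets n) ] weightIfExtension
        ≈⟨ Σ-concatMap gluings (subsets n) weightIfExtension ⟩
      Σ[ subsets n ] (λ B → Σ[ gluings B ] weightIfExtension)
        ≈⟨ Σ-cong (subsets n) (λ B → ≈-trans (Σ-concatMap (gluingsBelow B) (subsets n) _) (Σ-gluingsBelow B)) ⟩
      Σ[ subsets n ] (λ B → if downClosedᵇ R (lookup B) then extensionWeight (addAbove R (lookup B)) else 0#) ∎
      where
      isExtensionᵇ : Rel (suc n) → Bool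
      isExtensionᵇ G = isPosetᵇ G ∧ natLabᵇ G
      weightIfExtension : Rel (suc n) → Carrier
      weightIfExtension G = if isExtensionᵇ G then extensionWeight G else 0#
      gluingsBelow : Vec Bool n → Vec Bool n → List (Rel (suc n))
      gluingsBelow B A = map (glue R (lookup B) (lookup A)) bools
      gluings : Vec Bool n → List (Rel (suc n))
      gluings B = concatMap (gluingsBelow B) (subsets n)
      Σ-gluingsBelow : ∀ B → Σ[ subsets n ] (λ A → Σ[ gluingsBelow B A ] weightIfExtension)
        ≈ (if downClosedᵇ R (lookup B) then extensionWeight (addAbove R (lookup B)) else 0#)
      Σ-gluingsBelow B = begin
        Σ[ subsets n ] (λ A → Σ[ gluingsBelow B A ] weightIfExtension)
          ≈⟨ Σ-cong (subsets n) (λ A → extension-iff-empty A) ⟩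
        Σ[ subsets n ] (λ A → if does (A ≟ᵛ ∅) then W (glue R (lookup B) (lookup A) true) else 0#)
          ≈⟨ Σ-subsets-≟ ∅ (λ A → W (glue R (lookup B) (lookup A) true)) ⟩
        W (glue R (lookup B) (lookup ∅) true)
          ≡⟨ cong (λ w → if closed then w else 0#)
               (extensionWeight-cong (glue-cong R true (λ _ → refl) (lookup∘tabulate (λ _ → false)))) ⟩
        W (addAbove R (lookup B)) ∎
        where
        closed = downClosedᵇ R (lookup B)
        W : Rel (suc n) → Carrier
        W G = if closed then extensionWeight G else 0#
        extension-iff-empty : ∀ A → Σ[ gluingsBelow B A ] weightIfExtension
          ≈ (if does (A ≟ᵛ ∅) then W (glue R (lookup B) (lookup A) true) else 0#)
        extension-iff-empty A = begin
          weightIfExtension (glue R (lookup B) (lookup A) true)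
            + (weightIfExtension (glue R (lookup B) (lookup A) false) + 0#)
            ≡⟨ cong₂ (λ e f → (if e then extensionWeight (glue R (lookup B) (lookup A) true) else 0#)
                            + ((if f then extensionWeight (glue R (lookup B) (lookup A) false) else 0#) + 0#))
                 (isExtensionᵇ-glue P natural B A true) (isExtensionᵇ-glue P natural B A false) ⟩
          (if does (A ≟ᵛ ∅) ∧ closed then extensionWeight (glue R (lookup B) (lookup A) true) else 0#) + (0# + 0#)
            ≈⟨ ≈-trans (+-congˡ (+-identityʳ 0#)) (+-identityʳ _) ⟩
          (if does (A ≟ᵛ ∅) ∧ closed then extensionWeight (glue R (lookup B) (lookup A) true) else 0#)
            ≡⟨ if-∧ (does (A ≟ᵛ ∅)) closed _ ⟩
          (if does (A ≟ᵛ ∅) then W (glue R (lookup B) (lookup A) true) else 0#) ∎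

    coeff-M≈Σ-downSets : ∀ s → (∀ i → s i ≈ 1#) → coeff Q (M s t R) ≈ Σ[ subsets n ] (λ D →
      if isoᵇ (addAbove R (lookup D)) Q
      then Σ[ subsets n ] (λ S → if does (D ≟ᵛ Vec.tabulate (downᵇ R S)) then t (card S) else 0#)
      else 0#)
    coeff-M≈Σ-downSets s s₁ = begin
      coeff Q (M s t R)
        ≈⟨ coeff-M s t R Q ⟩
      Σ[ subsets n ] (λ S → if isoᵇ (B R S) Q then t (card S) * s (n ∸ card S) else 0#)
        ≈⟨ Σ-cong (subsets n) (λ S → if-cong (isoᵇ (B R S) Q) (≈-trans (*-congˡ (s₁ _)) (*-identityʳ _))) ⟩
      Σ[ subsets n ] (λ S → if isoᵇ (B R S) Q then t (card S) else 0#)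
        ≈⟨ Σ-cong (subsets n) (λ S →
             ≈-sym (≈-trans (Σ-subsets-≟ (Vec.tabulate (downᵇ R S)) (term S)) (reflexive (downSet S)))) ⟩
      Σ[ subsets n ] (λ S → Σ[ subsets n ] (λ D → if does (D ≟ᵛ Vec.tabulate (downᵇ R S)) then term S D else 0#))
        ≈⟨ Σ-swap (subsets n) (subsets n) _ ⟩
      Σ[ subsets n ] (λ D → Σ[ subsets n ] (λ S → if does (D ≟ᵛ Vec.tabulate (downᵇ R S)) then term S D else 0#))
        ≈⟨ Σ-cong (subsets n) (λ D → ≈-trans
             (Σ-cong (subsets n) (λ S → reflexive (if-swap (does (D ≟ᵛ _)) (isoᵇ (addAbove R (lookup D)) Q) _)))
             (Σ-if (subsets n) (isoᵇ (addAbove R (lookup D)) Q) _)) ⟩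
      Σ[ subsets n ] (λ D → if isoᵇ (addAbove R (lookup D)) Q
        then Σ[ subsets n ] (λ S → if does (D ≟ᵛ Vec.tabulate (downᵇ R S)) then t (card S) else 0#)
        else 0#) ∎
      where
      term : Vec Bool n → Vec Bool n → Carrier
      term S D = if isoᵇ (addAbove R (lookup D)) Q then t (card S) else 0#
      downSet : ∀ S → term S (Vec.tabulate (downᵇ R S)) ≡ (if isoᵇ (B R S) Q then t (card S) else 0#)
      downSet S = cong (λ b → if b then t (card S) else 0#)
        (isoᵇ-cong Q (glue-cong R true (lookup∘tabulate (downᵇ R S)) (λ _ → refl)))

    extensionWeight≈Σ-preimage : ∀ D →
      (if downClosedᵇ R (lookup D) then extensionWeight (addAbove R (lookup D)) else 0#)
      ≈ (if isoᵇ (addAbove R (lookup D)) Q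
         then Σ[ subsets n ] (λ S → if does (D ≟ᵛ Vec.tabulate (downᵇ R S)) then t (card S) else 0#)
         else 0#)
    extensionWeight≈Σ-preimage D = begin
      (if closed then (if isoᵇ G Q then L else 0#) else 0#)  ≡⟨ if-swap closed (isoᵇ G Q) L ⟩
      (if isoᵇ G Q then (if closed then L else 0#) else 0#)  ≈⟨ if-cong (isoᵇ G Q) (≈-sym Σ-down≈) ⟩
      (if isoᵇ G Q
       then Σ[ subsets n ] (λ S → if does (D ≟ᵛ Vec.tabulate (downᵇ R S)) then t (card S) else 0#)
       else 0#) ∎
      where
      G = addAbove R (lookup D)
      closed = downClosedᵇ R (lookup D)
      L = lam t (varpi G) (coveredCount G)
      interval : Vec Bool n → Bool
      interval = inIntervalᵇ (maxima R D) D
      max⊆D : lookup (maxima R D) ⊆ lookup D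
      max⊆D i = ∧-proj₁ ∘ subst T (lookup∘tabulate (maximalᵇ R (lookup D)) i)
      Σ-down≈ : Σ[ subsets n ] (λ S → if does (D ≟ᵛ Vec.tabulate (downᵇ R S)) then t (card S) else 0#)
                ≈ (if closed then L else 0#)
      Σ-down≈ = begin
        Σ[ subsets n ] (λ S → if does (D ≟ᵛ Vec.tabulate (downᵇ R S)) then t (card S) else 0#)
          ≈⟨ Σ-cong (subsets n) (λ S → reflexive (trans
               (cong (λ b → if b then t (card S) else 0#) (does-≟-downᵇ P natural D S))
               (if-∧ closed (interval S) (t (card S))))) ⟩
        Σ[ subsets n ] (λ S → if closed then (if interval S then t (card S) else 0#) else 0#)
          ≈⟨ Σ-if (subsets n) closed _ ⟩
        (if closed then Σ[ subsets n ] (λ S → if interval S then t (card S) else 0#) else 0#)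
          ≈⟨ if-cong closed (Σ-interval (maxima R D) D t max⊆D) ⟩
        (if closed then lam t (card D) (card (maxima R D)) else 0#)
          ≡⟨ cong₂ (λ k p → if closed then lam t k p else 0#)
               (sym (varpi-addAbove R (lookup D)))
               (trans (countᵇ-cong n (lookup∘tabulate (maximalᵇ R (lookup D))))
                      (sym (coveredCount-addAbove R (lookup D)))) ⟩
        (if closed then L else 0#) ∎

    w≈coeff-M : ∀ s → (∀ i → s i ≈ 1#) → w t R Q ≈ coeff Q (M s t R)
    w≈coeff-M s s₁ = begin
      w t R Q
        ≈⟨ w≈Σ-downClosed ⟩
      Σ[ subsets n ] (λ D → if downClosedᵇ R (lookup D) then extensionWeight (addAbove R (lookup D)) else 0#)
        ≈⟨ Σ-cong (subsets n) extensionWeight≈Σ-preimage ⟩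
      Σ[ subsets n ] (λ D → if isoᵇ (addAbove R (lookup D)) Q
        then Σ[ subsets n ] (λ S → if does (D ≟ᵛ Vec.tabulate (downᵇ R S)) then t (card S) else 0#)
        else 0#)
        ≈⟨ coeff-M≈Σ-downSets s s₁ ⟨
      coeff Q (M s t R) ∎

lemma3p3 : ∀ {c ℓ} (𝓡 : CommutativeSemiring c ℓ) →
    let open CommutativeSemiring 𝓡
        open Span 𝓡
    in
    -- (i) forests with roots maximal
    (∀ (s t : ℕ → Carrier) →
      s 0 ≈ 1# → (∀ i → s (suc i) ≈ 0#) → (∀ j → t j ≈ 1#) →
      ∀ {n} (f : Rel n) → IsPoset f → IsForest f →
      [ (1# , (suc n , B₊ f)) ] ≋ M s t f)
    ×
    -- (ii) rooted trees with root minimal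
    (∀ (s t : ℕ → Carrier) →
      t 1 ≈ 1# → (∀ i → ¬ (i ≡ 1) → t i ≈ 0#) → (∀ j → s j ≈ 1#) →
      ∀ {n} (T : Rel n) → IsPoset T → IsRootedTree T →
      N T ≋ M s t T)
    ×
    -- (iii) CSG transition weights; R is a naturally labelled representative of C_n
    (∀ (s t : ℕ → Carrier) → (∀ i → s i ≈ 1#) →
      ∀ {n} (R : Rel n) → IsPoset R → NatLabelled R →
      ∀ m (Q : Rel m) → w t R Q ≈ coeff Q (M s t R))
lemma3p3 𝓡 =
    -- (i) holds for every finite poset and (ii) for every relation: the shape hypotheses are unused.
    (λ s t s₀ s₊ t₁ f isPoset _ → Expansions.B₊≋M 𝓡 s t s₀ s₊ t₁ f isPoset)
  , (λ s t t₁ t₀ s₁ T _ _ → Expansions.N≋M 𝓡 s t t₁ t₀ s₁ T)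
  , (λ s t s₁ R isPoset natLab m Q →
       Expansions.w≈coeff-M 𝓡 t isPoset (Equivalence.from (Decisions.natLabᵇ⇔ 𝓡) natLab) Q s s₁)
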